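{- Let $\mathcal{G}=(G_1,\dots,G_r)$ be a sequence of graphs on a common vertex set $V$ with $|V|=n$, let $\alpha\ge 0$, and let $\epsilon>0$. Consider the algorithm FDS-IP, which runs as follows. 1. It starts with the interval $L=0$ and $U=r\frac{n-1}{2}$. 2. It performs a binary search. At each step it takes the midpoint $\gamma=(L+U)/2$ and solves $\mathrm{FDS}(\gamma)$ exactly. If the optimal solution is nonempty it sets $L=\gamma$; otherwise it sets $U=\gamma$. 3. It stops once $|U-L|\le\epsilon L$ and returns an optimal solution $S$ of $\mathrm{FDS}(L)$. Here $\mathrm{FDS}(\gamma)$ is the problem: maximize $\sum_{i=1}^r m(S,G_i)-\gamma|S|$ over $S\subseteq V$ subject to $b(S,\mathcal{G})\le\alpha|S|$. Let $\gamma=d(S,\mathcal{G})$ be the score of the returned solution. Let $\gamma^*$ be the optimal value of FDS, i.e. the maximum of $d(S,\mathcal{G})$ over nonempty $S\subseteq V$ with $\Delta(S,\mathcal{G})\le\alpha$. Then $\gamma\ge\gamma^*/(1+\epsilon)$. Moreover, if $\epsilon\le\frac{1}{rn^3}$, then $\gamma=\gamma^*$.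
   Context: Each $G_i=(V,E_i)$ is a simple undirected graph. For $S\subseteq V$, $m(S,G_i)$ is the number of edges of $E_i$ with both endpoints in $S$. The edge difference is $b(S,\mathcal{G})=\max_i m(S,G_i)-\min_i m(S,G_i)$. For nonempty $S$, the density is $d(S,G_i)=m(S,G_i)/|S|$. The total density is $d(S,\mathcal{G})=\sum_i d(S,G_i)$. The density difference is $\Delta(S,\mathcal{G})=\max_i d(S,G_i)-\min_i d(S,G_i)$. -}

module Defs where

open import Data.Bool using (Bool; true; false; _∧_; if_then_else_)
open import Data.Nat as ℕ using (ℕ; zero; suc)
open import Data.Fin as Fin using (Fin)
open import Data.Fin.Subset using (Subset; ⊥) renaming (∣_∣ to size)
open import Data.Vec using (lookup)
open import Data.List using (List; map; allFin)
open import Data.Nat.ListAction using (sum)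
open import Data.Integer using (ℤ; +_)
open import Data.Rational
  using (ℚ; _/_; 0ℚ; 1ℚ; ½; _+_; _-_; _*_; _≤_; _<_)
  renaming (∣_∣ to absℚ)
open import Data.Product using (_×_; Σ; ∃)
open import Relation.Binary.PropositionalEquality using (_≡_; _≢_)
open import Relation.Nullary.Decidable using (⌊_⌋)

record Graph (n : ℕ) : Set where
  field
    adj    : Fin n → Fin n → Bool
    sym    : ∀ i j → adj i j ≡ adj j i
    irrefl : ∀ i → adj i i ≡ false
open Graph public

ℕ→ℚ : ℕ → ℚ
ℕ→ℚ k = (+ k) / 1

-- m(S,G): number of edges {i,j} (counted once, via toℕ i < toℕ j)
-- with both endpoints in S.
edgesIn : ∀ {n} → Subset n → Graph n → ℕ
edgesIn {n} S G =
  sum (map (λ i → sum (map (λ j →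
        if ⌊ i Fin.<? j ⌋ ∧ adj G i j ∧ lookup S i ∧ lookup S j
        then 1 else 0) (allFin n))) (allFin n))

maxF : ∀ k → (Fin (suc k) → ℕ) → ℕ
maxF zero    f = f Fin.zero
maxF (suc k) f = f Fin.zero ℕ.⊔ maxF k (λ i → f (Fin.suc i))

minF : ∀ k → (Fin (suc k) → ℕ) → ℕ
minF zero    f = f Fin.zero
minF (suc k) f = f Fin.zero ℕ.⊓ minF k (λ i → f (Fin.suc i))

-- A sequence G_1..G_r of graphs on a common vertex set Fin n (r = suc k ≥ 1).
Seq : ℕ → ℕ → Set
Seq k n = Fin (suc k) → Graph n

totalEdges : ∀ {k n} → Seq k n → Subset n → ℕ
totalEdges {k} 𝒢 S = sum (map (λ i → edgesIn S (𝒢 i)) (allFin (suc k)))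

edgeDiff : ∀ {k n} → Seq k n → Subset n → ℕ
edgeDiff {k} 𝒢 S = maxF k (λ i → edgesIn S (𝒢 i)) ℕ.∸ minF k (λ i → edgesIn S (𝒢 i))

-- density m/|S| for |S| ≥ 1 (value at |S| = 0 is a dummy 0, never used)
dens : ℕ → ℕ → ℚ
dens m zero    = 0ℚ
dens m (suc s) = (+ m) / suc s

densG : ∀ {n} → Subset n → Graph n → ℚ
densG S G = dens (edgesIn S G) (size S)

totalDens : ∀ {k n} → Seq k n → Subset n → ℚ
totalDens {k} 𝒢 S = Data.List.foldr _+_ 0ℚ (map (λ i → densG S (𝒢 i)) (allFin (suc k)))

maxQ : ∀ k → (Fin (suc k) → ℚ) → ℚ
maxQ zero    f = f Fin.zero
maxQ (suc k) f = f Fin.zero Data.Rational.⊔ maxQ k (λ i → f (Fin.suc i))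

minQ : ∀ k → (Fin (suc k) → ℚ) → ℚ
minQ zero    f = f Fin.zero
minQ (suc k) f = f Fin.zero Data.Rational.⊓ minQ k (λ i → f (Fin.suc i))

densDiff : ∀ {k n} → Seq k n → Subset n → ℚ
densDiff {k} 𝒢 S = maxQ k (λ i → densG S (𝒢 i)) - minQ k (λ i → densG S (𝒢 i))

FDSFeasible : ∀ {k n} → Seq k n → ℚ → Subset n → Set
FDSFeasible 𝒢 α S = (S ≢ ⊥) × (densDiff 𝒢 S ≤ α)

IsFDSOptValue : ∀ {k n} → Seq k n → ℚ → ℚ → Set
IsFDSOptValue {n = n} 𝒢 α γ* =
  (Σ (Subset n) λ S → FDSFeasible 𝒢 α S × totalDens 𝒢 S ≡ γ*)
  × (∀ T → FDSFeasible 𝒢 α T → totalDens 𝒢 T ≤ γ*)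

FDSγObj : ∀ {k n} → Seq k n → ℚ → Subset n → ℚ
FDSγObj 𝒢 γ S = ℕ→ℚ (totalEdges 𝒢 S) - γ * ℕ→ℚ (size S)

FDSγFeasible : ∀ {k n} → Seq k n → ℚ → Subset n → Set
FDSγFeasible 𝒢 α S = ℕ→ℚ (edgeDiff 𝒢 S) ≤ α * ℕ→ℚ (size S)

IsFDSγOpt : ∀ {k n} → Seq k n → ℚ → ℚ → Subset n → Set
IsFDSγOpt 𝒢 α γ S =
  FDSγFeasible 𝒢 α S
  × (∀ T → FDSγFeasible 𝒢 α T → FDSγObj 𝒢 γ T ≤ FDSγObj 𝒢 γ S)

-- Algorithm FDS-IP (binary search).  The exact solver may return any
-- optimal solution, so the run is modelled as a relation:
-- Reach 𝒢 α ε L U  means that (L,U) is a reachable interval.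

initU : ℕ → ℕ → ℚ
initU k n = ℕ→ℚ (suc k) * ℕ→ℚ (n ℕ.∸ 1) * ½

mid : ℚ → ℚ → ℚ
mid L U = (L + U) * ½

data Reach {k n} (𝒢 : Seq k n) (α ε : ℚ) : ℚ → ℚ → Set where
  start : Reach 𝒢 α ε 0ℚ (initU k n)
  stepL : ∀ {L U} → Reach 𝒢 α ε L U → ε * L < absℚ (U - L) →
          (S : Subset n) → IsFDSγOpt 𝒢 α (mid L U) S → S ≢ ⊥ →
          Reach 𝒢 α ε (mid L U) U
  stepU : ∀ {L U} → Reach 𝒢 α ε L U → ε * L < absℚ (U - L) →
          (S : Subset n) → IsFDSγOpt 𝒢 α (mid L U) S → S ≡ ⊥ →
          Reach 𝒢 α ε L (mid L U)

Output : ∀ {k n} → Seq k n → ℚ → ℚ → Subset n → Set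
Output {n = n} 𝒢 α ε S =
  Σ ℚ λ L → Σ ℚ λ U →
    Reach 𝒢 α ε L U × (absℚ (U - L) ≤ ε * L) × IsFDSγOpt 𝒢 α L S

{-# OPTIONS --safe #-}

-- Every density is a ratio e/s of naturals, and for nonempty S the FDS(γ)
-- objective is |S| · (d(S) − γ) while its constraint is |S| · Δ(S) ≤ α |S|.
-- Hence an empty optimum of FDS(γ) shows that every FDS-feasible set has
-- density ≤ γ, and a nonempty optimum S, which beats ∅, has d(S) ≥ γ.  So the
-- binary search keeps U above γ* (initially because each G_i has at most
-- |S|(|S|−1)/2 edges inside S) and returns S with d(S) ≥ L; stopping gives
-- U ≤ (1+ε)L, hence γ* ≤ (1+ε) d(S).  For exactness write γ* = e'/s' and
-- d(S) = e/s: clearing denominators, e's ≤ (1+ε) es' < es' + 1 because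
-- es' < r n³ and ε r n³ ≤ 1, so e's ≤ es' by integrality, i.e. γ* ≤ d(S).

module Submission where

open import Defs
open import Data.Bool using (Bool; true; false; _∧_; if_then_else_)
open import Data.Fin as Fin using (Fin)
open import Data.Fin.Subset using (Subset; ⊥) renaming (∣_∣ to size)
open import Data.Fin.Subset.Properties using (∣p∣≤n; ∣⊥∣≡0)
open import Data.Integer as ℤ using (+_)
import Data.Integer.Properties as ℤ
open import Data.List using (List; []; _∷_; map; allFin; foldr; length)
import Data.List.Properties as List
open import Data.Nat as ℕ using (ℕ; suc; _^_; NonZero)
open import Data.Nat.ListAction using (sum)
import Data.Nat.Properties as ℕ
open import Data.Nat.Tactic.RingSolver using (solve-∀)
open import Data.Product using (_×_; _,_; proj₁)
open import Data.Rational as ℚ using (ℚ; 0ℚ; 1ℚ; ½; _+_; _-_; _*_; _⊔_; _⊓_; ∣_∣; _≤_; _<_)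
import Data.Rational.Properties as ℚ
open import Data.Rational.Solver using (module +-*-Solver)
open import Data.Rational.Unnormalised as ℚᵘ using (mkℚᵘ; *≡*; *≤*)
import Data.Rational.Unnormalised.Properties as ℚᵘ
open import Data.Sum using (inj₁; inj₂)
open import Data.Vec using (_∷_; []; lookup)
open import Function using (_∘_; id; mk⇔)
open import Relation.Binary.PropositionalEquality
  using (_≡_; _≢_; refl; trans; cong; cong₂; subst; subst₂; module ≡-Reasoning)
  renaming (sym to ≡-sym)
open import Relation.Nullary.Decidable using (⌊_⌋; does; isYes≗does; does-⇔)

open +-*-Solver using (solve; _:=_; _:+_; _:*_; _:-_; con)

toℚᵘ-ℕ→ℚ : ∀ m → ℚ.toℚᵘ (ℕ→ℚ m) ℚᵘ.≃ mkℚᵘ (+ m) 0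
toℚᵘ-ℕ→ℚ m = ℚ.toℚᵘ-fromℚᵘ (mkℚᵘ (+ m) 0)

ℕ→ℚ-+ : ∀ m n → ℕ→ℚ (m ℕ.+ n) ≡ ℕ→ℚ m + ℕ→ℚ n
ℕ→ℚ-+ m n = ℚ.toℚᵘ-injective (begin-equality
  ℚ.toℚᵘ (ℕ→ℚ (m ℕ.+ n))                       ≃⟨ toℚᵘ-ℕ→ℚ (m ℕ.+ n) ⟩
  mkℚᵘ (+ (m ℕ.+ n)) 0                          ≃⟨ *≡* (cong (ℤ._* ℤ.1ℤ) +[m+n]≡) ⟩
  mkℚᵘ (+ m) 0 ℚᵘ.+ mkℚᵘ (+ n) 0                ≃⟨ ℚᵘ.≃-sym (ℚᵘ.+-cong (toℚᵘ-ℕ→ℚ m) (toℚᵘ-ℕ→ℚ n)) ⟩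
  ℚ.toℚᵘ (ℕ→ℚ m) ℚᵘ.+ ℚ.toℚᵘ (ℕ→ℚ n)          ≃⟨ ℚᵘ.≃-sym (ℚ.toℚᵘ-homo-+ (ℕ→ℚ m) (ℕ→ℚ n)) ⟩
  ℚ.toℚᵘ (ℕ→ℚ m + ℕ→ℚ n)                       ∎)
  where
  open ℚᵘ.≤-Reasoning
  +[m+n]≡ : + (m ℕ.+ n) ≡ + m ℤ.* ℤ.1ℤ ℤ.+ + n ℤ.* ℤ.1ℤ
  +[m+n]≡ = trans (ℤ.pos-+ m n) (≡-sym (cong₂ ℤ._+_ (ℤ.*-identityʳ (+ m)) (ℤ.*-identityʳ (+ n))))

ℕ→ℚ-* : ∀ m n → ℕ→ℚ (m ℕ.* n) ≡ ℕ→ℚ m * ℕ→ℚ n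
ℕ→ℚ-* m n = ℚ.toℚᵘ-injective (begin-equality
  ℚ.toℚᵘ (ℕ→ℚ (m ℕ.* n))                       ≃⟨ toℚᵘ-ℕ→ℚ (m ℕ.* n) ⟩
  mkℚᵘ (+ (m ℕ.* n)) 0                          ≃⟨ *≡* (cong (ℤ._* ℤ.1ℤ) (ℤ.pos-* m n)) ⟩
  mkℚᵘ (+ m) 0 ℚᵘ.* mkℚᵘ (+ n) 0                ≃⟨ ℚᵘ.≃-sym (ℚᵘ.*-cong (toℚᵘ-ℕ→ℚ m) (toℚᵘ-ℕ→ℚ n)) ⟩
  ℚ.toℚᵘ (ℕ→ℚ m) ℚᵘ.* ℚ.toℚᵘ (ℕ→ℚ n)          ≃⟨ ℚᵘ.≃-sym (ℚ.toℚᵘ-homo-* (ℕ→ℚ m) (ℕ→ℚ n)) ⟩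
  ℚ.toℚᵘ (ℕ→ℚ m * ℕ→ℚ n)                       ∎)
  where open ℚᵘ.≤-Reasoning

ℕ→ℚ-mono-≤ : ∀ {m n} → m ℕ.≤ n → ℕ→ℚ m ≤ ℕ→ℚ n
ℕ→ℚ-mono-≤ {m} {n} m≤n = ℚ.toℚᵘ-cancel-≤ (begin
  ℚ.toℚᵘ (ℕ→ℚ m)  ≃⟨ toℚᵘ-ℕ→ℚ m ⟩
  mkℚᵘ (+ m) 0     ≤⟨ *≤* (ℤ.*-monoʳ-≤-nonNeg ℤ.1ℤ (ℤ.+≤+ m≤n)) ⟩
  mkℚᵘ (+ n) 0     ≃⟨ ℚᵘ.≃-sym (toℚᵘ-ℕ→ℚ n) ⟩
  ℚ.toℚᵘ (ℕ→ℚ n)  ∎)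
  where open ℚᵘ.≤-Reasoning

ℕ→ℚ-cancel-≤ : ∀ {m n} → ℕ→ℚ m ≤ ℕ→ℚ n → m ℕ.≤ n
ℕ→ℚ-cancel-≤ {m} {n} le
  with *≤* m≤n ← ℚᵘ.≤-respʳ-≃ (toℚᵘ-ℕ→ℚ n) (ℚᵘ.≤-respˡ-≃ (toℚᵘ-ℕ→ℚ m) (ℚ.toℚᵘ-mono-≤ le))
  = ℤ.drop‿+≤+ (subst₂ ℤ._≤_ (ℤ.*-identityʳ (+ m)) (ℤ.*-identityʳ (+ n)) m≤n)

ℕ→ℚ-mono-< : ∀ {m n} → m ℕ.< n → ℕ→ℚ m < ℕ→ℚ n
ℕ→ℚ-mono-< {m} {n} m<n = ℚ.≰⇒> (ℕ.<⇒≱ m<n ∘ ℕ→ℚ-cancel-≤ {n} {m})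

ℕ→ℚ-cancel-< : ∀ {m n} → ℕ→ℚ m < ℕ→ℚ n → m ℕ.< n
ℕ→ℚ-cancel-< {m} {n} lt = ℕ.≰⇒> (λ n≤m → ℚ.<-irrefl refl (ℚ.<-≤-trans lt (ℕ→ℚ-mono-≤ {n} {m} n≤m)))

0≤ℕ→ℚ : ∀ m → 0ℚ ≤ ℕ→ℚ m
0≤ℕ→ℚ m = ℕ→ℚ-mono-≤ {0} {m} ℕ.z≤n

0<ℕ→ℚ : ∀ m .{{_ : NonZero m}} → 0ℚ < ℕ→ℚ m
0<ℕ→ℚ m = ℕ→ℚ-mono-< (ℕ.>-nonZero⁻¹ m)

ℕ→ℚ-∸ : ∀ {m n} → n ℕ.≤ m → ℕ→ℚ (m ℕ.∸ n) ≡ ℕ→ℚ m - ℕ→ℚ n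
ℕ→ℚ-∸ {m} {n} n≤m = begin
  ℕ→ℚ (m ℕ.∸ n)                          ≡⟨ solve 2 (λ x y → x := (x :+ y) :- y) refl (ℕ→ℚ (m ℕ.∸ n)) (ℕ→ℚ n) ⟩
  (ℕ→ℚ (m ℕ.∸ n) + ℕ→ℚ n) - ℕ→ℚ n      ≡⟨ cong (_- ℕ→ℚ n) (≡-sym (ℕ→ℚ-+ (m ℕ.∸ n) n)) ⟩
  ℕ→ℚ (m ℕ.∸ n ℕ.+ n) - ℕ→ℚ n           ≡⟨ cong (λ k → ℕ→ℚ k - ℕ→ℚ n) (ℕ.m∸n+n≡m n≤m) ⟩
  ℕ→ℚ m - ℕ→ℚ n                          ∎
  where open ≡-Reasoning

ℕ→ℚ-⊔ : ∀ m n → ℕ→ℚ (m ℕ.⊔ n) ≡ ℕ→ℚ m ⊔ ℕ→ℚ n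
ℕ→ℚ-⊔ m n with ℕ.≤-total m n
... | inj₁ m≤n = trans (cong ℕ→ℚ (ℕ.m≤n⇒m⊔n≡n m≤n)) (≡-sym (ℚ.p≤q⇒p⊔q≡q (ℕ→ℚ-mono-≤ m≤n)))
... | inj₂ n≤m = trans (cong ℕ→ℚ (ℕ.m≥n⇒m⊔n≡m n≤m)) (≡-sym (ℚ.p≥q⇒p⊔q≡p (ℕ→ℚ-mono-≤ n≤m)))

ℕ→ℚ-⊓ : ∀ m n → ℕ→ℚ (m ℕ.⊓ n) ≡ ℕ→ℚ m ⊓ ℕ→ℚ n
ℕ→ℚ-⊓ m n with ℕ.≤-total m n
... | inj₁ m≤n = trans (cong ℕ→ℚ (ℕ.m≤n⇒m⊓n≡m m≤n)) (≡-sym (ℚ.p≤q⇒p⊓q≡p (ℕ→ℚ-mono-≤ m≤n)))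
... | inj₂ n≤m = trans (cong ℕ→ℚ (ℕ.m≥n⇒m⊓n≡n n≤m)) (≡-sym (ℚ.p≥q⇒p⊓q≡q (ℕ→ℚ-mono-≤ n≤m)))

*-ℕ→ℚ-monoʳ-≤ : ∀ m {p q} → p ≤ q → p * ℕ→ℚ m ≤ q * ℕ→ℚ m
*-ℕ→ℚ-monoʳ-≤ m = ℚ.*-monoʳ-≤-nonNeg (ℕ→ℚ m) {{ℚ.nonNegative (0≤ℕ→ℚ m)}}

*-ℕ→ℚ-cancelʳ-≤ : ∀ m .{{_ : NonZero m}} {p q} → p * ℕ→ℚ m ≤ q * ℕ→ℚ m → p ≤ q
*-ℕ→ℚ-cancelʳ-≤ m = ℚ.*-cancelʳ-≤-pos (ℕ→ℚ m) {{ℚ.positive (0<ℕ→ℚ m)}}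

p-q≤0⇒p≤q : ∀ {p q} → p - q ≤ 0ℚ → p ≤ q
p-q≤0⇒p≤q {p} {q} p-q≤0 = begin
  p             ≡⟨ solve 2 (λ p q → p := (p :- q) :+ q) refl p q ⟩
  (p - q) + q   ≤⟨ ℚ.+-monoˡ-≤ q p-q≤0 ⟩
  0ℚ + q        ≡⟨ ℚ.+-identityˡ q ⟩
  q             ∎
  where open ℚ.≤-Reasoning

0≤p-q⇒q≤p : ∀ {p q} → 0ℚ ≤ p - q → q ≤ p
0≤p-q⇒q≤p {p} {q} 0≤p-q = begin
  q             ≡⟨ ≡-sym (ℚ.+-identityˡ q) ⟩
  0ℚ + q        ≤⟨ ℚ.+-monoˡ-≤ q 0≤p-q ⟩
  (p - q) + q   ≡⟨ solve 2 (λ p q → (p :- q) :+ q := p) refl p q ⟩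
  p             ∎
  where open ℚ.≤-Reasoning

p≤∣p∣ : ∀ p → p ≤ ∣ p ∣
p≤∣p∣ p with ℚ.≤-total p 0ℚ
... | inj₁ p≤0 = ℚ.≤-trans p≤0 (ℚ.0≤∣p∣ p)
... | inj₂ 0≤p = ℚ.≤-reflexive (≡-sym (ℚ.0≤p⇒∣p∣≡p 0≤p))

-- Counting edges

sum-map-cong : ∀ {A : Set} {f g : A → ℕ} → (∀ x → f x ≡ g x) → ∀ xs → sum (map f xs) ≡ sum (map g xs)
sum-map-cong f≗g xs = cong sum (List.map-cong f≗g xs)

sum-map-mono-≤ : ∀ {A : Set} {f g : A → ℕ} → (∀ x → f x ℕ.≤ g x) → ∀ xs → sum (map f xs) ℕ.≤ sum (map g xs)
sum-map-mono-≤ f≤g []       = ℕ.z≤n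
sum-map-mono-≤ f≤g (x ∷ xs) = ℕ.+-mono-≤ (f≤g x) (sum-map-mono-≤ f≤g xs)

sum-map-const : ∀ {A : Set} c (xs : List A) → sum (map (λ _ → c) xs) ≡ length xs ℕ.* c
sum-map-const c []       = refl
sum-map-const c (x ∷ xs) = cong (c ℕ.+_) (sum-map-const c xs)

sum-allFin-const : ∀ n c → sum (map (λ _ → c) (allFin n)) ≡ n ℕ.* c
sum-allFin-const n c = trans (sum-map-const c (allFin n)) (cong (ℕ._* c) (List.length-tabulate {n = n} id))

sum-allFin-suc : ∀ {n} (f : Fin (suc n) → ℕ) →
  sum (map f (allFin (suc n))) ≡ f Fin.zero ℕ.+ sum (map (f ∘ Fin.suc) (allFin n))
sum-allFin-suc {n} f = cong (λ xs → f Fin.zero ℕ.+ sum xs)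
  (trans (List.map-tabulate Fin.suc f) (≡-sym (List.map-tabulate id (f ∘ Fin.suc))))

𝟙 : Bool → ℕ
𝟙 b = if b then 1 else 0

count : ∀ {n} → (Fin n → Bool) → ℕ
count {n} p = sum (map (𝟙 ∘ p) (allFin n))

count₂ : ∀ {n} → (Fin n → Fin n → Bool) → ℕ
count₂ {n} p = sum (map (count ∘ p) (allFin n))

count₂-mono-≤ : ∀ {n} {p q : Fin n → Fin n → Bool} →
  (∀ i j → 𝟙 (p i j) ℕ.≤ 𝟙 (q i j)) → count₂ p ℕ.≤ count₂ q
count₂-mono-≤ {n} p≤q = sum-map-mono-≤ (λ i → sum-map-mono-≤ (p≤q i) (allFin n)) (allFin n)

count-lookup : ∀ {n} (S : Subset n) → count (lookup S) ≡ size S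
count-lookup []          = refl
count-lookup (true ∷ S)  = trans (sum-allFin-suc (𝟙 ∘ lookup (true ∷ S))) (cong suc (count-lookup S))
count-lookup (false ∷ S) = trans (sum-allFin-suc (𝟙 ∘ lookup (false ∷ S))) (count-lookup S)

count-false : ∀ n → count {n} (λ _ → false) ≡ 0
count-false n = trans (sum-allFin-const n 0) (ℕ.*-zeroʳ n)

⌊<?⌋-suc : ∀ {n} (i j : Fin n) → ⌊ Fin.suc i Fin.<? Fin.suc j ⌋ ≡ ⌊ i Fin.<? j ⌋
⌊<?⌋-suc i j = begin
  ⌊ Fin.suc i Fin.<? Fin.suc j ⌋   ≡⟨ isYes≗does (Fin.suc i Fin.<? Fin.suc j) ⟩
  does (Fin.suc i Fin.<? Fin.suc j) ≡⟨ does-⇔ (mk⇔ ℕ.s<s⁻¹ ℕ.s<s) (Fin.suc i Fin.<? Fin.suc j) (i Fin.<? j) ⟩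
  does (i Fin.<? j)                 ≡⟨ ≡-sym (isYes≗does (i Fin.<? j)) ⟩
  ⌊ i Fin.<? j ⌋                   ∎
  where open ≡-Reasoning

pairs : ∀ {n} → Subset n → ℕ
pairs S = count₂ (λ i j → ⌊ i Fin.<? j ⌋ ∧ lookup S i ∧ lookup S j)

pairs-∷ : ∀ {n} x (S : Subset n) → pairs (x ∷ S) ≡ count (λ j → x ∧ lookup S j) ℕ.+ pairs S
pairs-∷ {n} x S = begin
  pairs (x ∷ S)
    ≡⟨ sum-allFin-suc (count ∘ P) ⟩
  count (P Fin.zero) ℕ.+ sum (map (count ∘ P ∘ Fin.suc) (allFin n))
    ≡⟨ cong₂ ℕ._+_ (sum-allFin-suc (𝟙 ∘ P Fin.zero)) (sum-map-cong row-suc (allFin n)) ⟩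
  count (λ j → x ∧ lookup S j) ℕ.+ pairs S
    ∎
  where
  open ≡-Reasoning
  P : Fin (suc n) → Fin (suc n) → Bool
  P i j = ⌊ i Fin.<? j ⌋ ∧ lookup (x ∷ S) i ∧ lookup (x ∷ S) j
  row-suc : ∀ i → count (P (Fin.suc i)) ≡ count (λ j → ⌊ i Fin.<? j ⌋ ∧ lookup S i ∧ lookup S j)
  row-suc i = trans (sum-allFin-suc (𝟙 ∘ P (Fin.suc i)))
    (sum-map-cong (λ j → cong (λ b → 𝟙 (b ∧ lookup S i ∧ lookup S j)) (⌊<?⌋-suc i j)) (allFin n))

-- 2 · pairs S ≤ |S| (|S| − 1), kept free of truncated subtraction.
pairs-bound : ∀ {n} (S : Subset n) → pairs S ℕ.* 2 ℕ.+ size S ℕ.≤ size S ℕ.* size S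
pairs-bound []          = ℕ.z≤n
pairs-bound {suc n} (false ∷ S) rewrite pairs-∷ false S | count-false n = pairs-bound S
pairs-bound (true ∷ S)  rewrite pairs-∷ true S | count-lookup S = begin
  (s ℕ.+ p) ℕ.* 2 ℕ.+ suc s           ≡⟨ regroup s p ⟩
  (p ℕ.* 2 ℕ.+ s) ℕ.+ suc (s ℕ.+ s)   ≤⟨ ℕ.+-monoˡ-≤ (suc (s ℕ.+ s)) (pairs-bound S) ⟩
  s ℕ.* s ℕ.+ suc (s ℕ.+ s)           ≡⟨ square-suc s ⟩
  suc s ℕ.* suc s                     ∎
  where
  open ℕ.≤-Reasoning
  s = size S
  p = pairs S
  regroup : ∀ s p → (s ℕ.+ p) ℕ.* 2 ℕ.+ suc s ≡ (p ℕ.* 2 ℕ.+ s) ℕ.+ suc (s ℕ.+ s)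
  regroup = solve-∀
  square-suc : ∀ s → s ℕ.* s ℕ.+ suc (s ℕ.+ s) ≡ suc s ℕ.* suc s
  square-suc = solve-∀

edgesIn≤pairs : ∀ {n} (S : Subset n) (G : Graph n) → edgesIn S G ℕ.≤ pairs S
edgesIn≤pairs S G = count₂-mono-≤ (λ i j → drop-middle ⌊ i Fin.<? j ⌋ (adj G i j) (lookup S i ∧ lookup S j))
  where
  drop-middle : ∀ a b c → 𝟙 (a ∧ b ∧ c) ℕ.≤ 𝟙 (a ∧ c)
  drop-middle false _     _ = ℕ.z≤n
  drop-middle true  false _ = ℕ.z≤n
  drop-middle true  true  _ = ℕ.≤-refl

pairs-⊥ : ∀ n → pairs (⊥ {n}) ≡ 0
pairs-⊥ ℕ.zero  = refl
pairs-⊥ (suc n) = trans (pairs-∷ false (⊥ {n})) (cong₂ ℕ._+_ (count-false n) (pairs-⊥ n))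

edgesIn-⊥ : ∀ {n} (G : Graph n) → edgesIn ⊥ G ≡ 0
edgesIn-⊥ {n} G = ℕ.n≤0⇒n≡0 (subst (edgesIn ⊥ G ℕ.≤_) (pairs-⊥ n) (edgesIn≤pairs ⊥ G))

totalEdges≤pairs : ∀ {k n} (𝒢 : Seq k n) S → totalEdges 𝒢 S ℕ.≤ suc k ℕ.* pairs S
totalEdges≤pairs {k} 𝒢 S = ℕ.≤-trans
  (sum-map-mono-≤ (λ i → edgesIn≤pairs S (𝒢 i)) (allFin (suc k)))
  (ℕ.≤-reflexive (sum-allFin-const (suc k) (pairs S)))

totalEdges-⊥ : ∀ {k n} (𝒢 : Seq k n) → totalEdges 𝒢 ⊥ ≡ 0
totalEdges-⊥ {k} {n} 𝒢 = ℕ.n≤0⇒n≡0 (subst (totalEdges 𝒢 ⊥ ℕ.≤_) (ℕ.*-zeroʳ (suc k))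
  (subst (λ p → totalEdges 𝒢 ⊥ ℕ.≤ suc k ℕ.* p) (pairs-⊥ n) (totalEdges≤pairs 𝒢 ⊥)))

totalEdges-bound : ∀ {k n} (𝒢 : Seq k n) S →
  totalEdges 𝒢 S ℕ.* 2 ℕ.+ suc k ℕ.* size S ℕ.≤ suc k ℕ.* (size S ℕ.* size S)
totalEdges-bound {k} 𝒢 S = begin
  e ℕ.* 2 ℕ.+ r ℕ.* s           ≤⟨ ℕ.+-monoˡ-≤ (r ℕ.* s) (ℕ.*-monoˡ-≤ 2 (totalEdges≤pairs 𝒢 S)) ⟩
  r ℕ.* p ℕ.* 2 ℕ.+ r ℕ.* s     ≡⟨ factor r p s ⟩
  r ℕ.* (p ℕ.* 2 ℕ.+ s)         ≤⟨ ℕ.*-monoʳ-≤ r (pairs-bound S) ⟩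
  r ℕ.* (s ℕ.* s)               ∎
  where
  open ℕ.≤-Reasoning
  e = totalEdges 𝒢 S
  r = suc k
  s = size S
  p = pairs S
  factor : ∀ r p s → r ℕ.* p ℕ.* 2 ℕ.+ r ℕ.* s ≡ r ℕ.* (p ℕ.* 2 ℕ.+ s)
  factor = solve-∀

totalEdges*2≤ : ∀ {k n} (𝒢 : Seq k n) S → totalEdges 𝒢 S ℕ.* 2 ℕ.≤ suc k ℕ.* (n ℕ.∸ 1) ℕ.* size S
totalEdges*2≤ {k} {n} 𝒢 S = begin
  e ℕ.* 2                             ≤⟨ ℕ.m+n≤o⇒m≤o∸n (e ℕ.* 2) (totalEdges-bound 𝒢 S) ⟩
  r ℕ.* (s ℕ.* s) ℕ.∸ r ℕ.* s        ≡⟨ ≡-sym (ℕ.*-distribˡ-∸ r (s ℕ.* s) s) ⟩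
  r ℕ.* (s ℕ.* s ℕ.∸ s)              ≡⟨ cong (r ℕ.*_) [s∸1]*s≡s*s∸s ⟨
  r ℕ.* ((s ℕ.∸ 1) ℕ.* s)            ≡⟨ ℕ.*-assoc r (s ℕ.∸ 1) s ⟨
  r ℕ.* (s ℕ.∸ 1) ℕ.* s              ≤⟨ ℕ.*-monoˡ-≤ s (ℕ.*-monoʳ-≤ r (ℕ.∸-monoˡ-≤ 1 (∣p∣≤n S))) ⟩
  r ℕ.* (n ℕ.∸ 1) ℕ.* s              ∎
  where
  open ℕ.≤-Reasoning
  e = totalEdges 𝒢 S
  r = suc k
  s = size S
  [s∸1]*s≡s*s∸s : (s ℕ.∸ 1) ℕ.* s ≡ s ℕ.* s ℕ.∸ s
  [s∸1]*s≡s*s∸s = trans (ℕ.*-distribʳ-∸ s s 1) (cong (s ℕ.* s ℕ.∸_) (ℕ.*-identityˡ s))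

size≡0⇒≡⊥ : ∀ {n} (S : Subset n) → size S ≡ 0 → S ≡ ⊥
size≡0⇒≡⊥ []          _  = refl
size≡0⇒≡⊥ (false ∷ S) eq = cong (false ∷_) (size≡0⇒≡⊥ S eq)

size-nonZero : ∀ {n} {S : Subset n} → S ≢ ⊥ → NonZero (size S)
size-nonZero {S = S} S≢⊥ = ℕ.≢-nonZero (S≢⊥ ∘ size≡0⇒≡⊥ S)

totalEdges< : ∀ {k n} (𝒢 : Seq k n) {S} → S ≢ ⊥ → totalEdges 𝒢 S ℕ.< suc k ℕ.* (n ℕ.* n)
totalEdges< {k} {n} 𝒢 {S} S≢⊥ = begin-strict
  e                        ≤⟨ ℕ.m≤m*n e 2 ⟩
  e ℕ.* 2                  <⟨ ℕ.m<m+n (e ℕ.* 2) (ℕ.>-nonZero⁻¹ (r ℕ.* s) {{ℕ.m*n≢0 r s {{_}} {{size-nonZero S≢⊥}}}}) ⟩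
  e ℕ.* 2 ℕ.+ r ℕ.* s      ≤⟨ totalEdges-bound 𝒢 S ⟩
  r ℕ.* (s ℕ.* s)          ≤⟨ ℕ.*-monoʳ-≤ r (ℕ.*-mono-≤ (∣p∣≤n S) (∣p∣≤n S)) ⟩
  r ℕ.* (n ℕ.* n)          ∎
  where
  open ℕ.≤-Reasoning
  e = totalEdges 𝒢 S
  r = suc k
  s = size S

totalEdges*size< : ∀ {k n} (𝒢 : Seq k n) {S} → S ≢ ⊥ → ∀ T → totalEdges 𝒢 S ℕ.* size T ℕ.< suc k ℕ.* n ^ 3
totalEdges*size< {k} {n} 𝒢 {S} S≢⊥ T = begin-strict
  e ℕ.* size T                  ≤⟨ ℕ.*-monoʳ-≤ e (∣p∣≤n T) ⟩
  e ℕ.* n                       <⟨ ℕ.*-monoˡ-< n {{n≢0}} (totalEdges< 𝒢 S≢⊥) ⟩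
  suc k ℕ.* (n ℕ.* n) ℕ.* n     ≡⟨ cube (suc k) n ⟩
  suc k ℕ.* n ^ 3               ∎
  where
  open ℕ.≤-Reasoning
  e = totalEdges 𝒢 S
  n≢0 : NonZero n
  n≢0 = ℕ.>-nonZero (ℕ.<-≤-trans (ℕ.>-nonZero⁻¹ (size S) {{size-nonZero S≢⊥}}) (∣p∣≤n S))
  cube : ∀ r n → r ℕ.* (n ℕ.* n) ℕ.* n ≡ r ℕ.* (n ℕ.* (n ℕ.* (n ℕ.* 1)))
  cube = solve-∀

maxF-lub : ∀ k (f : Fin (suc k) → ℕ) {c} → (∀ i → f i ℕ.≤ c) → maxF k f ℕ.≤ c
maxF-lub ℕ.zero    f f≤c = f≤c Fin.zero
maxF-lub (suc k) f f≤c = ℕ.⊔-lub (f≤c Fin.zero) (maxF-lub k (f ∘ Fin.suc) (f≤c ∘ Fin.suc))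

minF≤maxF : ∀ k (f : Fin (suc k) → ℕ) → minF k f ℕ.≤ maxF k f
minF≤maxF ℕ.zero    f = ℕ.≤-refl
minF≤maxF (suc k) f = ℕ.≤-trans (ℕ.m⊓n≤m (f Fin.zero) _) (ℕ.m≤m⊔n (f Fin.zero) _)

edgeDiff-⊥ : ∀ {k n} (𝒢 : Seq k n) → edgeDiff 𝒢 ⊥ ≡ 0
edgeDiff-⊥ {k} 𝒢 = ℕ.n≤0⇒n≡0 (ℕ.≤-trans (ℕ.m∸n≤m _ (minF k (λ i → edgesIn ⊥ (𝒢 i))))
  (maxF-lub k (λ i → edgesIn ⊥ (𝒢 i)) (λ i → ℕ.≤-reflexive (edgesIn-⊥ (𝒢 i)))))

-- Densities as ratios

dens-* : ∀ m s .{{_ : NonZero s}} → dens m s * ℕ→ℚ s ≡ ℕ→ℚ m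
dens-* m (suc s) = ℚ.toℚᵘ-injective (begin-equality
  ℚ.toℚᵘ (dens m (suc s) * ℕ→ℚ (suc s))              ≃⟨ ℚ.toℚᵘ-homo-* (dens m (suc s)) (ℕ→ℚ (suc s)) ⟩
  ℚ.toℚᵘ (dens m (suc s)) ℚᵘ.* ℚ.toℚᵘ (ℕ→ℚ (suc s)) ≃⟨ ℚᵘ.*-cong (ℚ.toℚᵘ-fromℚᵘ (mkℚᵘ (+ m) s)) (toℚᵘ-ℕ→ℚ (suc s)) ⟩
  mkℚᵘ (+ m) s ℚᵘ.* mkℚᵘ (+ suc s) 0                   ≃⟨ *≡* m*[1+s]≡ ⟩
  mkℚᵘ (+ m) 0                                          ≃⟨ ℚᵘ.≃-sym (toℚᵘ-ℕ→ℚ m) ⟩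
  ℚ.toℚᵘ (ℕ→ℚ m)                                       ∎)
  where
  open ℚᵘ.≤-Reasoning
  m*[1+s]≡ : (+ m ℤ.* + suc s) ℤ.* ℤ.1ℤ ≡ + m ℤ.* + (suc s ℕ.* 1)
  m*[1+s]≡ = trans (ℤ.*-identityʳ _) (cong (λ t → + m ℤ.* + t) (≡-sym (ℕ.*-identityʳ (suc s))))

sum-dens-* : ∀ {A : Set} (g : A → ℕ) s .{{_ : NonZero s}} (xs : List A) →
  foldr _+_ 0ℚ (map (λ x → dens (g x) s) xs) * ℕ→ℚ s ≡ ℕ→ℚ (sum (map g xs))
sum-dens-* g s []       = ℚ.*-zeroˡ (ℕ→ℚ s)
sum-dens-* g s (x ∷ xs) = begin
  (dens (g x) s + rest) * ℕ→ℚ s                  ≡⟨ ℚ.*-distribʳ-+ (ℕ→ℚ s) (dens (g x) s) rest ⟩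
  dens (g x) s * ℕ→ℚ s + rest * ℕ→ℚ s           ≡⟨ cong₂ _+_ (dens-* (g x) s) (sum-dens-* g s xs) ⟩
  ℕ→ℚ (g x) + ℕ→ℚ (sum (map g xs))              ≡⟨ ℕ→ℚ-+ (g x) (sum (map g xs)) ⟨
  ℕ→ℚ (g x ℕ.+ sum (map g xs))                   ∎
  where
  open ≡-Reasoning
  rest : ℚ
  rest = foldr _+_ 0ℚ (map (λ x → dens (g x) s) xs)

maxQ-dens-* : ∀ k (f : Fin (suc k) → ℕ) s .{{_ : NonZero s}} →
  maxQ k (λ i → dens (f i) s) * ℕ→ℚ s ≡ ℕ→ℚ (maxF k f)
maxQ-dens-* ℕ.zero  f s = dens-* (f Fin.zero) s
maxQ-dens-* (suc k) f s = begin
  (dens (f Fin.zero) s ⊔ rest) * ℕ→ℚ s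
    ≡⟨ ℚ.*-distribʳ-⊔-nonNeg (ℕ→ℚ s) {{ℚ.nonNegative (0≤ℕ→ℚ s)}} (dens (f Fin.zero) s) rest ⟩
  (dens (f Fin.zero) s * ℕ→ℚ s) ⊔ (rest * ℕ→ℚ s)
    ≡⟨ cong₂ _⊔_ (dens-* (f Fin.zero) s) (maxQ-dens-* k (f ∘ Fin.suc) s) ⟩
  ℕ→ℚ (f Fin.zero) ⊔ ℕ→ℚ (maxF k (f ∘ Fin.suc))
    ≡⟨ ℕ→ℚ-⊔ (f Fin.zero) (maxF k (f ∘ Fin.suc)) ⟨
  ℕ→ℚ (f Fin.zero ℕ.⊔ maxF k (f ∘ Fin.suc))
    ∎
  where
  open ≡-Reasoning
  rest : ℚ
  rest = maxQ k (λ i → dens (f (Fin.suc i)) s)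

minQ-dens-* : ∀ k (f : Fin (suc k) → ℕ) s .{{_ : NonZero s}} →
  minQ k (λ i → dens (f i) s) * ℕ→ℚ s ≡ ℕ→ℚ (minF k f)
minQ-dens-* ℕ.zero  f s = dens-* (f Fin.zero) s
minQ-dens-* (suc k) f s = begin
  (dens (f Fin.zero) s ⊓ rest) * ℕ→ℚ s
    ≡⟨ ℚ.*-distribʳ-⊓-nonNeg (ℕ→ℚ s) {{ℚ.nonNegative (0≤ℕ→ℚ s)}} (dens (f Fin.zero) s) rest ⟩
  (dens (f Fin.zero) s * ℕ→ℚ s) ⊓ (rest * ℕ→ℚ s)
    ≡⟨ cong₂ _⊓_ (dens-* (f Fin.zero) s) (minQ-dens-* k (f ∘ Fin.suc) s) ⟩
  ℕ→ℚ (f Fin.zero) ⊓ ℕ→ℚ (minF k (f ∘ Fin.suc))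
    ≡⟨ ℕ→ℚ-⊓ (f Fin.zero) (minF k (f ∘ Fin.suc)) ⟨
  ℕ→ℚ (f Fin.zero ℕ.⊓ minF k (f ∘ Fin.suc))
    ∎
  where
  open ≡-Reasoning
  rest : ℚ
  rest = minQ k (λ i → dens (f (Fin.suc i)) s)

totalDens-* : ∀ {k n} (𝒢 : Seq k n) {S} → S ≢ ⊥ → totalDens 𝒢 S * ℕ→ℚ (size S) ≡ ℕ→ℚ (totalEdges 𝒢 S)
totalDens-* {k} 𝒢 {S} S≢⊥ = sum-dens-* (λ i → edgesIn S (𝒢 i)) (size S) {{size-nonZero S≢⊥}} (allFin (suc k))

totalDens-*ʳ : ∀ {k n} (𝒢 : Seq k n) {S} → S ≢ ⊥ → ∀ t →
  totalDens 𝒢 S * ℕ→ℚ (size S ℕ.* t) ≡ ℕ→ℚ (totalEdges 𝒢 S ℕ.* t)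
totalDens-*ʳ 𝒢 {S} S≢⊥ t = begin
  d * ℕ→ℚ (s ℕ.* t)       ≡⟨ cong (d *_) (ℕ→ℚ-* s t) ⟩
  d * (ℕ→ℚ s * ℕ→ℚ t)     ≡⟨ ℚ.*-assoc d (ℕ→ℚ s) (ℕ→ℚ t) ⟨
  d * ℕ→ℚ s * ℕ→ℚ t       ≡⟨ cong (_* ℕ→ℚ t) (totalDens-* 𝒢 S≢⊥) ⟩
  ℕ→ℚ e * ℕ→ℚ t           ≡⟨ ℕ→ℚ-* e t ⟨
  ℕ→ℚ (e ℕ.* t)           ∎
  where
  open ≡-Reasoning
  d = totalDens 𝒢 S
  s = size S
  e = totalEdges 𝒢 S

densDiff-* : ∀ {k n} (𝒢 : Seq k n) {S} → S ≢ ⊥ → densDiff 𝒢 S * ℕ→ℚ (size S) ≡ ℕ→ℚ (edgeDiff 𝒢 S)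
densDiff-* {k} 𝒢 {S} S≢⊥ = begin
  (maxQ k d - minQ k d) * ℕ→ℚ s
    ≡⟨ solve 3 (λ x y c → (x :- y) :* c := x :* c :- y :* c) refl (maxQ k d) (minQ k d) (ℕ→ℚ s) ⟩
  maxQ k d * ℕ→ℚ s - minQ k d * ℕ→ℚ s
    ≡⟨ cong₂ _-_ (maxQ-dens-* k f s {{s≢0}}) (minQ-dens-* k f s {{s≢0}}) ⟩
  ℕ→ℚ (maxF k f) - ℕ→ℚ (minF k f)
    ≡⟨ ℕ→ℚ-∸ (minF≤maxF k f) ⟨
  ℕ→ℚ (edgeDiff 𝒢 S)
    ∎
  where
  open ≡-Reasoning
  s = size S
  s≢0 : NonZero s
  s≢0 = size-nonZero S≢⊥
  f : Fin (suc k) → ℕ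
  f i = edgesIn S (𝒢 i)
  d : Fin (suc k) → ℚ
  d i = dens (f i) s

-- Integrality: a ≤ b + ε b < b + 1 forces a ≤ b.
ratio-≤-*[1+ε]⇒≤ : ∀ {x y ε} t .{{_ : NonZero t}} {a b} → x * ℕ→ℚ t ≡ ℕ→ℚ a → y * ℕ→ℚ t ≡ ℕ→ℚ b →
  ε * ℕ→ℚ b < 1ℚ → x ≤ y * (1ℚ + ε) → x ≤ y
ratio-≤-*[1+ε]⇒≤ {x} {y} {ε} t {a} {b} x*t≡a y*t≡b εb<1 x≤y[1+ε] = *-ℕ→ℚ-cancelʳ-≤ t (begin
  x * ℕ→ℚ t   ≡⟨ x*t≡a ⟩
  ℕ→ℚ a       ≤⟨ ℕ→ℚ-mono-≤ {a} {b} (ℕ.m<1+n⇒m≤n (ℕ→ℚ-cancel-< {a} {suc b} a<1+b)) ⟩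
  ℕ→ℚ b       ≡⟨ y*t≡b ⟨
  y * ℕ→ℚ t   ∎)
  where
  open ℚ.≤-Reasoning
  a<1+b : ℕ→ℚ a < ℕ→ℚ (suc b)
  a<1+b = begin-strict
    ℕ→ℚ a                      ≡⟨ x*t≡a ⟨
    x * ℕ→ℚ t                  ≤⟨ *-ℕ→ℚ-monoʳ-≤ t x≤y[1+ε] ⟩
    y * (1ℚ + ε) * ℕ→ℚ t
      ≡⟨ solve 3 (λ y e t → y :* (con 1ℚ :+ e) :* t := y :* t :+ e :* (y :* t)) refl y ε (ℕ→ℚ t) ⟩
    y * ℕ→ℚ t + ε * (y * ℕ→ℚ t) ≡⟨ cong (λ u → u + ε * u) y*t≡b ⟩
    ℕ→ℚ b + ε * ℕ→ℚ b          <⟨ ℚ.+-monoʳ-< (ℕ→ℚ b) εb<1 ⟩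
    ℕ→ℚ b + 1ℚ                 ≡⟨ ℕ→ℚ-+ b 1 ⟨
    ℕ→ℚ (b ℕ.+ 1)              ≡⟨ cong ℕ→ℚ (ℕ.+-comm b 1) ⟩
    ℕ→ℚ (suc b)                ∎

-- FDS(γ) versus FDS

FDSγObj-⊥ : ∀ {k n} (𝒢 : Seq k n) γ → FDSγObj 𝒢 γ ⊥ ≡ 0ℚ
FDSγObj-⊥ {n = n} 𝒢 γ rewrite totalEdges-⊥ 𝒢 | ∣⊥∣≡0 n | ℚ.*-zeroʳ γ = refl

FDSγFeasible-⊥ : ∀ {k n} (𝒢 : Seq k n) α → FDSγFeasible 𝒢 α ⊥
FDSγFeasible-⊥ {n = n} 𝒢 α rewrite edgeDiff-⊥ 𝒢 | ∣⊥∣≡0 n | ℚ.*-zeroʳ α = ℚ.≤-refl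

FDSFeasible⇒FDSγFeasible : ∀ {k n} (𝒢 : Seq k n) {α S} → FDSFeasible 𝒢 α S → FDSγFeasible 𝒢 α S
FDSFeasible⇒FDSγFeasible 𝒢 {α} {S} (S≢⊥ , Δ≤α) =
  subst (_≤ α * ℕ→ℚ (size S)) (densDiff-* 𝒢 S≢⊥) (*-ℕ→ℚ-monoʳ-≤ (size S) Δ≤α)

FDSγFeasible⇒FDSFeasible : ∀ {k n} (𝒢 : Seq k n) {α S} → S ≢ ⊥ → FDSγFeasible 𝒢 α S → FDSFeasible 𝒢 α S
FDSγFeasible⇒FDSFeasible 𝒢 {α} {S} S≢⊥ b≤αs = S≢⊥ , *-ℕ→ℚ-cancelʳ-≤ (size S) {{size-nonZero S≢⊥}}
  (subst (_≤ α * ℕ→ℚ (size S)) (≡-sym (densDiff-* 𝒢 S≢⊥)) b≤αs)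

FDSγObj≤0⇒totalDens≤ : ∀ {k n} (𝒢 : Seq k n) {γ S} → S ≢ ⊥ → FDSγObj 𝒢 γ S ≤ 0ℚ → totalDens 𝒢 S ≤ γ
FDSγObj≤0⇒totalDens≤ 𝒢 {γ} {S} S≢⊥ obj≤0 = *-ℕ→ℚ-cancelʳ-≤ (size S) {{size-nonZero S≢⊥}}
  (subst (_≤ γ * ℕ→ℚ (size S)) (≡-sym (totalDens-* 𝒢 S≢⊥)) (p-q≤0⇒p≤q obj≤0))

0≤FDSγObj⇒≤totalDens : ∀ {k n} (𝒢 : Seq k n) {γ S} → S ≢ ⊥ → 0ℚ ≤ FDSγObj 𝒢 γ S → γ ≤ totalDens 𝒢 S
0≤FDSγObj⇒≤totalDens 𝒢 {γ} {S} S≢⊥ 0≤obj = *-ℕ→ℚ-cancelʳ-≤ (size S) {{size-nonZero S≢⊥}}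
  (subst (γ * ℕ→ℚ (size S) ≤_) (≡-sym (totalDens-* 𝒢 S≢⊥)) (0≤p-q⇒q≤p 0≤obj))

FDSγOpt⇒≤totalDens : ∀ {k n} (𝒢 : Seq k n) {α γ S} → IsFDSγOpt 𝒢 α γ S → S ≢ ⊥ → γ ≤ totalDens 𝒢 S
FDSγOpt⇒≤totalDens 𝒢 {α} {γ} {S} (_ , optimal) S≢⊥ = 0≤FDSγObj⇒≤totalDens 𝒢 S≢⊥
  (subst (_≤ FDSγObj 𝒢 γ S) (FDSγObj-⊥ 𝒢 γ) (optimal ⊥ (FDSγFeasible-⊥ 𝒢 α)))

IsFDSUpperBound : ∀ {k n} → Seq k n → ℚ → ℚ → Set
IsFDSUpperBound 𝒢 α U = ∀ T → FDSFeasible 𝒢 α T → totalDens 𝒢 T ≤ U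

FDSγOpt-⊥⇒upperBound : ∀ {k n} (𝒢 : Seq k n) {α γ} → IsFDSγOpt 𝒢 α γ ⊥ → IsFDSUpperBound 𝒢 α γ
FDSγOpt-⊥⇒upperBound 𝒢 {γ = γ} (_ , optimal) T T-feas@(T≢⊥ , _) = FDSγObj≤0⇒totalDens≤ 𝒢 T≢⊥
  (subst (FDSγObj 𝒢 γ T ≤_) (FDSγObj-⊥ 𝒢 γ) (optimal T (FDSFeasible⇒FDSγFeasible 𝒢 T-feas)))

-- The binary search

initU-upperBound : ∀ {k n} (𝒢 : Seq k n) α → IsFDSUpperBound 𝒢 α (initU k n)
initU-upperBound {k} {n} 𝒢 α T (T≢⊥ , _) = *-ℕ→ℚ-cancelʳ-≤ s {{size-nonZero T≢⊥}} (begin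
  totalDens 𝒢 T * ℕ→ℚ s
    ≡⟨ totalDens-* 𝒢 T≢⊥ ⟩
  ℕ→ℚ e
    ≡⟨ solve 1 (λ x → x := x :* con (ℕ→ℚ 2) :* con ½) refl (ℕ→ℚ e) ⟩
  ℕ→ℚ e * ℕ→ℚ 2 * ½
    ≡⟨ cong (_* ½) (ℕ→ℚ-* e 2) ⟨
  ℕ→ℚ (e ℕ.* 2) * ½
    ≤⟨ ℚ.*-monoʳ-≤-nonNeg ½ (ℕ→ℚ-mono-≤ (totalEdges*2≤ 𝒢 T)) ⟩
  ℕ→ℚ (r ℕ.* (n ℕ.∸ 1) ℕ.* s) * ½
    ≡⟨ cong (_* ½) (trans (ℕ→ℚ-* (r ℕ.* (n ℕ.∸ 1)) s) (cong (_* ℕ→ℚ s) (ℕ→ℚ-* r (n ℕ.∸ 1)))) ⟩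
  ℕ→ℚ r * ℕ→ℚ (n ℕ.∸ 1) * ℕ→ℚ s * ½
    ≡⟨ solve 4 (λ a b c h → a :* b :* c :* h := a :* b :* h :* c) refl (ℕ→ℚ r) (ℕ→ℚ (n ℕ.∸ 1)) (ℕ→ℚ s) ½ ⟩
  initU k n * ℕ→ℚ s
    ∎)
  where
  open ℚ.≤-Reasoning
  r = suc k
  s = size T
  e = totalEdges 𝒢 T

Reach⇒upperBound : ∀ {k n} {𝒢 : Seq k n} {α ε L U} → Reach 𝒢 α ε L U → IsFDSUpperBound 𝒢 α U
Reach⇒upperBound {𝒢 = 𝒢} {α} start            = initU-upperBound 𝒢 α
Reach⇒upperBound (stepL reach _ _ _ _)            = Reach⇒upperBound reach
Reach⇒upperBound {𝒢 = 𝒢} (stepU _ _ _ ⊥-opt refl) = FDSγOpt-⊥⇒upperBound 𝒢 ⊥-opt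

stopped⇒U≤L[1+ε] : ∀ {ε L U} → ∣ U - L ∣ ≤ ε * L → U ≤ L * (1ℚ + ε)
stopped⇒U≤L[1+ε] {ε} {L} {U} ∣U-L∣≤εL = begin
  U               ≡⟨ solve 2 (λ u l → u := (u :- l) :+ l) refl U L ⟩
  (U - L) + L     ≤⟨ ℚ.+-monoˡ-≤ L (ℚ.≤-trans (p≤∣p∣ (U - L)) ∣U-L∣≤εL) ⟩
  ε * L + L       ≡⟨ solve 2 (λ e l → e :* l :+ l := l :* (con 1ℚ :+ e)) refl ε L ⟩
  L * (1ℚ + ε)    ∎
  where open ℚ.≤-Reasoning

totalDens-≤-*[1+ε]⇒≤ : ∀ {k n} (𝒢 : Seq k n) {S T ε} → S ≢ ⊥ → T ≢ ⊥ → 0ℚ < ε →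
  ε * ℕ→ℚ (suc k ℕ.* n ^ 3) ≤ 1ℚ →
  totalDens 𝒢 T ≤ totalDens 𝒢 S * (1ℚ + ε) → totalDens 𝒢 T ≤ totalDens 𝒢 S
totalDens-≤-*[1+ε]⇒≤ {k} {n} 𝒢 {S} {T} {ε} S≢⊥ T≢⊥ 0<ε ε-small = ratio-≤-*[1+ε]⇒≤ {ε = ε} (t ℕ.* s)
  {{ℕ.m*n≢0 t s {{size-nonZero T≢⊥}} {{size-nonZero S≢⊥}}}}
  {a = totalEdges 𝒢 T ℕ.* s} {b = totalEdges 𝒢 S ℕ.* t}
  (totalDens-*ʳ 𝒢 T≢⊥ s) S-ratio εet<1
  where
  s = size S
  t = size T
  S-ratio : totalDens 𝒢 S * ℕ→ℚ (t ℕ.* s) ≡ ℕ→ℚ (totalEdges 𝒢 S ℕ.* t)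
  S-ratio = trans (cong (λ u → totalDens 𝒢 S * ℕ→ℚ u) (ℕ.*-comm t s)) (totalDens-*ʳ 𝒢 S≢⊥ t)
  εet<1 : ε * ℕ→ℚ (totalEdges 𝒢 S ℕ.* t) < 1ℚ
  εet<1 = ℚ.<-≤-trans (ℚ.*-monoʳ-<-pos ε {{ℚ.positive 0<ε}} (ℕ→ℚ-mono-< (totalEdges*size< 𝒢 S≢⊥ T))) ε-small

proposition4 : ∀ (k n : ℕ) (𝒢 : Seq k n) (α ε : ℚ) → 0ℚ ≤ α → 0ℚ < ε →
    ∀ (S : Subset n) → Output 𝒢 α ε S → S ≢ ⊥ →
    ∀ (γ* : ℚ) → IsFDSOptValue 𝒢 α γ* →
    (γ* ≤ totalDens 𝒢 S * (1ℚ + ε))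
    × (ε * ℕ→ℚ (suc k ℕ.* n ^ 3) ≤ 1ℚ → totalDens 𝒢 S ≡ γ*)
proposition4 k n 𝒢 α ε _ 0<ε S (L , U , reach , ∣U-L∣≤εL , S-opt) S≢⊥ γ* ((T , T-feas , refl) , γ*-max) =
  γ*≤γ[1+ε] , λ ε-small →
    ℚ.≤-antisym (γ*-max S S-feas) (totalDens-≤-*[1+ε]⇒≤ 𝒢 S≢⊥ (proj₁ T-feas) 0<ε ε-small γ*≤γ[1+ε])
  where
  S-feas : FDSFeasible 𝒢 α S
  S-feas = FDSγFeasible⇒FDSFeasible 𝒢 {α} S≢⊥ (proj₁ S-opt)
  γ*≤γ[1+ε] : totalDens 𝒢 T ≤ totalDens 𝒢 S * (1ℚ + ε)
  γ*≤γ[1+ε] = begin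
    totalDens 𝒢 T              ≤⟨ Reach⇒upperBound reach T T-feas ⟩
    U                          ≤⟨ stopped⇒U≤L[1+ε] {ε} {L} ∣U-L∣≤εL ⟩
    L * (1ℚ + ε)               ≤⟨ ℚ.*-monoʳ-≤-nonNeg (1ℚ + ε) {{ℚ.nonNegative (ℚ.+-mono-≤ (ℚ.nonNegative⁻¹ 1ℚ) (ℚ.<⇒≤ 0<ε))}}
                                    (FDSγOpt⇒≤totalDens 𝒢 {α} {L} S-opt S≢⊥) ⟩
    totalDens 𝒢 S * (1ℚ + ε)   ∎
    where open ℚ.≤-Reasoning
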